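{- Let $G$ be a chordal graph and let $L$ be a perfect elimination ordering of $G$. Let $a$ be a colouring of $V(G)$ such that $a(v)\ne a(u)$ whenever $u$ is a predecessor of $v$ or $u$ is a predecessor of a predecessor of $v$. For a clique $K$ of $G$ let $\mu(K)$ be the smallest vertex of $K$ with respect to $L$, and define a colouring $c$ of $\mathit{AC}(G)$ by $c(z)=a(\mu(K))$, where $K$ is the clique corresponding to the vertex $z$. Let $K$ and $K^*$ be cliques of $G$ with corresponding vertices $z,z^*$ of $\mathit{AC}(G)$. If $K\cap K^*\ne\varnothing$ and $c(z)=c(z^*)$, then $\mu(K)=\mu(K^*)$.
   Context: A graph is chordal if every induced cycle is a triangle. A perfect elimination ordering of $G$ is a linear ordering $L$ of $V(G)$ such that for every vertex $v$, the neighbours of $v$ that are smaller than $v$ in $L$ form a clique; every chordal graph has one. A vertex $u$ is a predecessor of $v$ if $uv\in E(G)$ and $u<_L v$. A clique means a nonempty set of pairwise adjacent vertices (not necessarily maximal). Two cliques are adjacent if they are disjoint and some vertex of one is adjacent in $G$ to some vertex of the other. The adjacent-cliques graph $\mathit{AC}(G)$ has one vertex per clique of $G$, two vertices adjacent iff their cliques are adjacent. -}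

module Defs where

open import Data.Nat using (ℕ; _<_)
open import Data.Fin using (Fin)
open import Data.Fin.Subset using (Subset; _∈_; Nonempty)
open import Data.Product using (_×_; Σ; ∃)
open import Relation.Nullary using (¬_)
open import Relation.Binary.PropositionalEquality using (_≡_)
open import Level using (0ℓ; suc)

record Graph (n : ℕ) : Set₁ where
  field
    Adj   : Fin n → Fin n → Set
    sym   : ∀ {u v} → Adj u v → Adj v u
    irrefl : ∀ {v} → ¬ Adj v v

open Graph public

record LinearOrder (n : ℕ) : Set where
  field
    rank : Fin n → ℕ
    rank-inj : ∀ {u v} → rank u ≡ rank v → u ≡ v

open LinearOrder public

_<[_]_ : ∀ {n} → Fin n → LinearOrder n → Fin n → Set
u <[ L ] v = rank L u < rank L v

PairwiseAdj : ∀ {n} → Graph n → Subset n → Set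
PairwiseAdj G K = ∀ {u v} → u ∈ K → v ∈ K → ¬ (u ≡ v) → Adj G u v

IsClique : ∀ {n} → Graph n → Subset n → Set
IsClique G K = Nonempty K × PairwiseAdj G K

Pred : ∀ {n} → Graph n → LinearOrder n → Fin n → Fin n → Set
Pred G L u v = Adj G u v × (u <[ L ] v)

IsPEO : ∀ {n} → Graph n → LinearOrder n → Set
IsPEO G L = ∀ {v u w} → Pred G L u v → Pred G L w v → ¬ (u ≡ w) → Adj G u w

open import Data.Fin using (zero; suc; toℕ)
open import Data.Nat using (_≤_; _+_; _%_)
open import Data.Nat using (NonZero)

IsInducedCycle : ∀ {n} → Graph n → (k : ℕ) → (Fin k → Fin n) → Set
IsInducedCycle {n} G k c =
    (∀ {i j} → c i ≡ c j → i ≡ j)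
  × (∀ (i j : Fin k) → Adj G (c i) (c j) →
       (toℕ j ≡ Data.Nat.suc (toℕ i) ⊎ toℕ i ≡ Data.Nat.suc (toℕ j)
         ⊎ (Data.Nat.suc (toℕ i) ≡ k × toℕ j ≡ 0)
         ⊎ (Data.Nat.suc (toℕ j) ≡ k × toℕ i ≡ 0)))
  × (∀ (i j : Fin k) →
       (toℕ j ≡ Data.Nat.suc (toℕ i) ⊎ (Data.Nat.suc (toℕ i) ≡ k × toℕ j ≡ 0)) →
       Adj G (c i) (c j))
  where open import Data.Sum using (_⊎_)

-- Chordal: every induced cycle (length ≥ 3) is a triangle, i.e. no induced cycle of length ≥ 4.
IsChordal : ∀ {n} → Graph n → Set
IsChordal G = ∀ k (c : Fin k → _) → 3 ≤ k → IsInducedCycle G k c → k ≡ 3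

IsMinIn : ∀ {n} → LinearOrder n → Subset n → Fin n → Set
IsMinIn L K m = m ∈ K × (∀ {v} → v ∈ K → ¬ (v ≡ m) → m <[ L ] v)

-- Two distinct minima μ <_L ν of cliques sharing a vertex x are adjacent: either x = ν,
-- or μ and ν are both predecessors of x, hence adjacent by the perfect elimination property.
-- So μ is a predecessor of ν, which the colouring a forbids to share its colour.
module Submission where

open import Defs
open import Data.Nat using (ℕ)
open import Data.Nat.Properties using (<-cmp; <-trans; <-irrefl)
open import Data.Fin using (Fin; _≟_)
open import Data.Fin.Subset using (Subset; _∈_; _∩_; Nonempty)
open import Data.Fin.Subset.Properties using (x∈p∩q⁻)
open import Data.Product using (_,_; proj₂)
open import Data.Empty using (⊥-elim)
open import Relation.Nullary using (¬_; yes; no)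
open import Relation.Binary.Definitions using (tri<; tri≈; tri>)
open import Relation.Binary.PropositionalEquality using (_≡_; refl) renaming (sym to ≡-sym)

module _ {n : ℕ} (L : LinearOrder n) where

  <[]⇒≢ : ∀ {u v} → u <[ L ] v → ¬ u ≡ v
  <[]⇒≢ u<v refl = <-irrefl refl u<v

module _ {n : ℕ} (G : Graph n) (L : LinearOrder n) where

  min-pred-of-member : ∀ {K m v} → PairwiseAdj G K → IsMinIn L K m →
                       v ∈ K → ¬ v ≡ m → Pred G L m v
  min-pred-of-member cK (m∈K , m-min) v∈K v≢m =
    cK m∈K v∈K (λ m≡v → v≢m (≡-sym m≡v)) , m-min v∈K v≢m

  pred-of-intersecting-min : IsPEO G L → ∀ {K K* μ ν x} →
                             PairwiseAdj G K → PairwiseAdj G K* →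
                             IsMinIn L K μ → IsMinIn L K* ν →
                             x ∈ K → x ∈ K* → μ <[ L ] ν → Pred G L μ ν
  pred-of-intersecting-min peo {μ = μ} {ν} {x} cK cK* μ-min ν-min x∈K x∈K* μ<ν
    with x ≟ ν
  ... | yes refl = min-pred-of-member cK μ-min x∈K (λ x≡μ → <[]⇒≢ L μ<ν (≡-sym x≡μ))
  ... | no x≢ν   = peo μ-pred-x ν-pred-x (<[]⇒≢ L μ<ν) , μ<ν
    where
    ν-pred-x : Pred G L ν x
    ν-pred-x = min-pred-of-member cK* ν-min x∈K* x≢ν

    μ-pred-x : Pred G L μ x
    μ-pred-x = min-pred-of-member cK μ-min x∈K
                 (λ x≡μ → <[]⇒≢ L (<-trans μ<ν (proj₂ ν-pred-x)) (≡-sym x≡μ))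

lemma3p2 : ∀ {n : ℕ} {C : Set} (G : Graph n) (L : LinearOrder n)
    → IsChordal G
    → IsPEO G L
    → (a : Fin n → C)
    → (∀ {u v} → Pred G L u v → ¬ (a v ≡ a u))
    → (∀ {u w v} → Pred G L u w → Pred G L w v → ¬ (a v ≡ a u))
    → (K K* : Subset n) → IsClique G K → IsClique G K*
    → (μK μK* : Fin n) → IsMinIn L K μK → IsMinIn L K* μK*
    → Nonempty (K ∩ K*)
    → a μK ≡ a μK*
    → μK ≡ μK*
lemma3p2 G L _ peo a a-proper _ K K* (_ , cK) (_ , cK*) μ ν μ-min ν-min (x , x∈K∩K*) aμ≡aν
  with x∈p∩q⁻ K K* x∈K∩K* | <-cmp (rank L μ) (rank L ν)
... | _ , _       | tri≈ _ rμ≡rν _ = rank-inj L rμ≡rν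
... | x∈K , x∈K*  | tri< μ<ν _ _ =
  ⊥-elim (a-proper (pred-of-intersecting-min G L peo cK cK* μ-min ν-min x∈K x∈K* μ<ν) (≡-sym aμ≡aν))
... | x∈K , x∈K*  | tri> _ _ ν<μ =
  ⊥-elim (a-proper (pred-of-intersecting-min G L peo cK* cK ν-min μ-min x∈K* x∈K ν<μ) aμ≡aν)
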